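{- For $n\ge0$ let $D_{n}(231,132)$ be the set of derangements of $\{1,\dots,n\}$ (permutations with no fixed point) that avoid both patterns $231$ and $132$. Let $(J_n)_{n\ge0}$ be the Jacobsthal numbers $J_0=0$, $J_1=1$, $J_n=J_{n-1}+2J_{n-2}$ for $n\ge2$. Then for all $n\ge0$, $$J_{n+1}=\sum_{k=0}^n2^{n-k}\binom{k}{n-k}=|D_{n+2}(231,132)|.$$
   Context: A permutation $\pi$ avoids a pattern $p\in S_3$ if there are no indices $i<j<l$ such that $(\pi_i,\pi_j,\pi_l)$ is order-isomorphic to $p$. Binomial coefficients $\binom{k}{j}$ with $j>k$ or $j<0$ are $0$. -}

module Defs where

open import Data.Nat using (ℕ; zero; suc; _+_; _*_; _∸_; _^_)
open import Data.Nat.Combinatorics using (_C_)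
open import Data.Fin using (Fin; _<_)
open import Data.Vec using (Vec; lookup)
open import Data.List using (map; upTo)
open import Data.Nat.ListAction using (sum)
open import Data.Product using (Σ; _×_; ∃)
open import Relation.Binary.PropositionalEquality using (_≡_)
open import Relation.Nullary using (¬_)
open import Function.Definitions using (Injective)

J : ℕ → ℕ
J zero = 0
J (suc zero) = 1
J (suc (suc n)) = J (suc n) + 2 * J n

-- Σ_{k=0}^{n} 2^{n-k} * binom(k, n-k)   (binom(k,j) = 0 for j > k)
jacobSum : ℕ → ℕ
jacobSum n = sum (map (λ k → 2 ^ (n ∸ k) * (k C (n ∸ k))) (upTo (suc n)))

-- A permutation of {1..n} is represented (0-based) by its one-line
-- notation π = (π₀,…,π_{n-1}) : Vec (Fin n) n with all entries distinct.
IsPerm : ∀ {n} → Vec (Fin n) n → Set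
IsPerm {n} π = Injective _≡_ _≡_ (lookup π)

IsDerangement : ∀ {n} → Vec (Fin n) n → Set
IsDerangement {n} π = (i : Fin n) → ¬ (lookup π i ≡ i)

Occ231 : ∀ {n} → Vec (Fin n) n → Set
Occ231 {n} π = Σ (Fin n) λ i → Σ (Fin n) λ j → Σ (Fin n) λ l →
  i < j × j < l × lookup π l < lookup π i × lookup π i < lookup π j

Occ132 : ∀ {n} → Vec (Fin n) n → Set
Occ132 {n} π = Σ (Fin n) λ i → Σ (Fin n) λ j → Σ (Fin n) λ l →
  i < j × j < l × lookup π i < lookup π l × lookup π l < lookup π j

InD : (n : ℕ) → Vec (Fin n) n → Set
InD n π = IsPerm π × IsDerangement π × ¬ Occ231 π × ¬ Occ132 π

-- |{a : A | P a}| = m : there is an injection Fin m → A whose image is exactly P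
HasCard : {A : Set} → (A → Set) → ℕ → Set
HasCard {A} P m = Σ (Fin m → A) λ f →
  Injective _≡_ _≡_ f × ((i : Fin m) → P (f i)) × ((a : A) → P a → ∃ λ i → f i ≡ a)

-- In a permutation avoiding 231 and 132 the maximum stands first or last: if it
-- stood strictly inside, the first and last entries would form 132 or 231 with
-- it.  Deleting it therefore leaves a smaller permutation of the same kind, and
-- the derangement condition π(i) ≠ i becomes π(i) ≠ i + 1 when the maximum was
-- first.  So one counts the class with π(i) ≠ i + d for every shift d: for d ≥ 1
-- both insertions are allowed except at the single size where the first entry
-- would land on the forbidden diagonal, which gives the Jacobsthal recurrence.
-- The binomial sum satisfies the same recurrence by Pascal's rule.
module Submission where

open import Data.Bool.Base using (if_then_else_)
open import Data.Empty using (⊥-elim)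
open import Data.Fin.Base
  using (Fin; zero; suc; toℕ; fromℕ; inject₁; lower₁; splitAt; _↑ˡ_; _↑ʳ_; _<_)
import Data.Fin.Properties as Fin
open import Data.List.Base using (applyUpTo; _∷_; []) renaming (_++_ to _++ˡ_)
import Data.List.Properties as List
open import Data.Nat.Base as ℕ using (ℕ; zero; suc; _+_; _*_; _∸_; _^_; z<s; s<s)
import Data.Nat.Properties as ℕ
open import Data.Nat.Combinatorics using (_C_; nCk+nC[k+1]≡[n+1]C[k+1])
open import Data.Nat.ListAction using (sum)
open import Data.Nat.ListAction.Properties using (sum-++)
open import Algebra.Properties.CommutativeSemigroup ℕ.+-commutativeSemigroup
  using () renaming (interchange to +-interchange)
open import Data.Product.Base using (Σ; ∃; _×_; _,_; proj₂; map₂)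
open import Data.Sum.Base using (_⊎_; inj₁; inj₂; [_,_])
open import Data.Vec.Base using (Vec; []; _∷_; lookup; tabulate)
import Data.Vec.Properties as Vec
open import Function.Base using (_∘_)
open import Function.Definitions using (Injective)
open import Relation.Binary.Core using (_Preserves_⟶_)
open import Relation.Binary.Definitions using (tri<; tri≈; tri>)
open import Relation.Binary.PropositionalEquality
  using (_≡_; _≢_; _≗_; refl; sym; trans; cong; cong₂; subst; subst₂; module ≡-Reasoning)
open import Relation.Nullary.Decidable using (Dec; does; yes; no)
open import Relation.Nullary.Negation using (¬_)
open import Relation.Unary using (Pred; _⊆_; _∪_; _⊥_; _⊢_; ｛_｝; Empty)
open import Level using (0ℓ)

open import Defs

private
  variable
    A B X : Set
    m n d : ℕ

-- Cardinalities

Image : (B → A) → Pred B 0ℓ → Pred A 0ℓ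
Image g Q a = ∃ λ b → Q b × g b ≡ a

unless : Dec X → ℕ → ℕ
unless c m = if does c then 0 else m

hasCard-empty : {P : Pred A 0ℓ} → Empty P → HasCard P 0
hasCard-empty ∉P = (λ ()) , (λ { {()} }) , (λ ()) , λ a a∈P → ⊥-elim (∉P a a∈P)

module _ {P Q : Pred A 0ℓ} where

  hasCard-cong : P ⊆ Q → Q ⊆ P → HasCard P m → HasCard Q m
  hasCard-cong P⊆Q Q⊆P (f , f-inj , f∈P , onto) =
    f , f-inj , (λ i → P⊆Q (f∈P i)) , λ a a∈Q → onto a (Q⊆P a∈Q)

  hasCard-∪ : HasCard P m → HasCard Q n → P ⊥ Q → HasCard (P ∪ Q) (m + n)
  hasCard-∪ {m} {n} (f , f-inj , f∈P , f-onto) (g , g-inj , g∈Q , g-onto) P⊥Q =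
    h , h-inj , h∈P∪Q , h-onto
    where
    h : Fin (m + n) → A
    h = [ f , g ] ∘ splitAt m

    h-inj : Injective _≡_ _≡_ h
    h-inj {x} {y} e with splitAt m x in sx | splitAt m y in sy
    ... | inj₁ x′ | inj₁ y′ =
      trans (sym (Fin.splitAt⁻¹-↑ˡ sx)) (trans (cong (_↑ˡ n) (f-inj e)) (Fin.splitAt⁻¹-↑ˡ sy))
    ... | inj₁ x′ | inj₂ y′ = ⊥-elim (P⊥Q (f∈P x′ , subst Q (sym e) (g∈Q y′)))
    ... | inj₂ x′ | inj₁ y′ = ⊥-elim (P⊥Q (f∈P y′ , subst Q e (g∈Q x′)))
    ... | inj₂ x′ | inj₂ y′ =
      trans (sym (Fin.splitAt⁻¹-↑ʳ sx)) (trans (cong (m ↑ʳ_) (g-inj e)) (Fin.splitAt⁻¹-↑ʳ sy))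

    h∈P∪Q : ∀ i → (P ∪ Q) (h i)
    h∈P∪Q i with splitAt m i
    ... | inj₁ x = inj₁ (f∈P x)
    ... | inj₂ y = inj₂ (g∈Q y)

    h-onto : ∀ a → (P ∪ Q) a → ∃ λ i → h i ≡ a
    h-onto a (inj₁ a∈P) with i , fi≡a ← f-onto a a∈P =
      i ↑ˡ n , trans (cong [ f , g ] (Fin.splitAt-↑ˡ m i n)) fi≡a
    h-onto a (inj₂ a∈Q) with i , gi≡a ← g-onto a a∈Q =
      m ↑ʳ i , trans (cong [ f , g ] (Fin.splitAt-↑ʳ m n i)) gi≡a

hasCard-singleton : (a : A) → HasCard ｛ a ｝ 1
hasCard-singleton a =
  (λ _ → a) , (λ { {zero} {zero} _ → refl }) , (λ _ → refl) , λ b a≡b → zero , a≡b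

hasCard-image : {Q : Pred B 0ℓ} (g : B → A) → Injective _≡_ _≡_ g →
                HasCard Q m → HasCard (Image g Q) m
hasCard-image g g-inj (f , f-inj , f∈Q , onto) =
  g ∘ f , f-inj ∘ g-inj , (λ i → f i , f∈Q i , refl) ,
  λ { a (b , b∈Q , refl) → let (i , fi≡b) = onto b b∈Q in i , cong g fi≡b }

hasCard-unless : {Q : Pred A 0ℓ} (c : Dec X) → HasCard Q m →
                 HasCard (λ a → ¬ X × Q a) (unless c m)
hasCard-unless (yes c) _ = hasCard-empty λ _ (¬c , _) → ¬c c
hasCard-unless (no ¬c) = hasCard-cong (¬c ,_) proj₂

-- Patterns and the shifted diagonal

module _ {a b : ℕ} where

  Contains231 Contains132 : (Fin a → Fin b) → Set
  Contains231 f = Σ (Fin a) λ i → Σ (Fin a) λ j → Σ (Fin a) λ l →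
    i < j × j < l × f l < f i × f i < f j
  Contains132 f = Σ (Fin a) λ i → Σ (Fin a) λ j → Σ (Fin a) λ l →
    i < j × j < l × f i < f l × f l < f j

module _ {a a′ b b′ : ℕ} {e : Fin a → Fin a′} {h : Fin b → Fin b′}
         (e-mono : e Preserves _<_ ⟶ _<_) (h-mono : h Preserves _<_ ⟶ _<_)
         {f : Fin a → Fin b} {g : Fin a′ → Fin b′} (g∘e≗h∘f : ∀ i → g (e i) ≡ h (f i)) where

  private
    transport-< : ∀ {x y} → f x < f y → g (e x) < g (e y)
    transport-< {x} {y} fx<fy = subst₂ _<_ (sym (g∘e≗h∘f x)) (sym (g∘e≗h∘f y)) (h-mono fx<fy)

  Contains231-transport : Contains231 f → Contains231 g
  Contains231-transport (i , j , l , i<j , j<l , r , s) =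
    e i , e j , e l , e-mono i<j , e-mono j<l , transport-< r , transport-< s

  Contains132-transport : Contains132 f → Contains132 g
  Contains132-transport (i , j , l , i<j , j<l , r , s) =
    e i , e j , e l , e-mono i<j , e-mono j<l , transport-< r , transport-< s

OffDiagonal : ℕ → (Fin n → Fin n) → Set
OffDiagonal d f = ∀ i → toℕ (f i) ≢ toℕ i + d

-- ShiftedD 0 is the class D(231,132); other shifts arise on deleting a leading maximum.
ShiftedD : ℕ → (Fin n → Fin n) → Set
ShiftedD d f = Injective _≡_ _≡_ f × ¬ Contains231 f × ¬ Contains132 f × OffDiagonal d f

ShiftedD-resp : {f g : Fin n → Fin n} → f ≗ g → ShiftedD d f → ShiftedD d g
ShiftedD-resp {f = f} {g} f≗g (f-inj , ¬231 , ¬132 , off) =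
  (λ {x} {y} e → f-inj (trans (f≗g x) (trans e (sym (f≗g y))))) ,
  ¬231 ∘ Contains231-transport (λ p → p) (λ p → p) f≗g ,
  ¬132 ∘ Contains132-transport (λ p → p) (λ p → p) f≗g ,
  λ i e → off i (trans (cong toℕ (f≗g i)) e)

-- Inserting a new maximum

fromℕ-maximal : {i : Fin (suc n)} → ¬ fromℕ n < i
fromℕ-maximal {i = i} = ℕ.≤⇒≯ (Fin.≤fromℕ i)

inject₁-mono-< : inject₁ {n} Preserves _<_ ⟶ _<_
inject₁-mono-< {x = i} {j} = subst₂ ℕ._<_ (sym (Fin.toℕ-inject₁ i)) (sym (Fin.toℕ-inject₁ j))

inject₁-cancel-< : {i j : Fin n} → inject₁ i < inject₁ j → i < j
inject₁-cancel-< {i = i} {j} = subst₂ ℕ._<_ (Fin.toℕ-inject₁ i) (Fin.toℕ-inject₁ j)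

inject₁<fromℕ : (i : Fin n) → inject₁ i < fromℕ n
inject₁<fromℕ {n} i = subst (toℕ (inject₁ i) ℕ.<_) (sym (Fin.toℕ-fromℕ n)) (Fin.inject₁ℕ< i)

data LastView : Fin (suc n) → Set where
  last : LastView (fromℕ n)
  init : (i : Fin n) → LastView (inject₁ i)

lastView : (i : Fin (suc n)) → LastView i
lastView {zero}  zero    = last
lastView {suc n} zero    = init zero
lastView {suc n} (suc i) with lastView i
... | last   = last
... | init j = init (suc j)

below-inject₁ : {i : Fin (suc n)} {j : Fin n} → i < inject₁ j → ∃ λ i′ → i ≡ inject₁ i′
below-inject₁ {i = i} {j} i<j with lastView i
... | init i′ = i′ , refl
... | last    = ⊥-elim (fromℕ-maximal {i = inject₁ j} i<j)

snoc : (Fin n → A) → A → Fin (suc n) → A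
snoc {zero}  f x zero    = x
snoc {suc n} f x zero    = f zero
snoc {suc n} f x (suc i) = snoc (f ∘ suc) x i

snoc-fromℕ : (f : Fin n → A) (x : A) → snoc f x (fromℕ n) ≡ x
snoc-fromℕ {zero}  f x = refl
snoc-fromℕ {suc n} f x = snoc-fromℕ (f ∘ suc) x

snoc-inject₁ : (f : Fin n → A) (x : A) (i : Fin n) → snoc f x (inject₁ i) ≡ f i
snoc-inject₁ {suc n} f x zero    = refl
snoc-inject₁ {suc n} f x (suc i) = snoc-inject₁ (f ∘ suc) x i

snoc-cong : {f g : Fin n → A} (x : A) → f ≗ g → snoc f x ≗ snoc g x
snoc-cong {zero}  x f≗g zero    = refl
snoc-cong {suc n} x f≗g zero    = f≗g zero
snoc-cong {suc n} x f≗g (suc i) = snoc-cong x (f≗g ∘ suc) i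

prependMax appendMax : (Fin n → Fin n) → Fin (suc n) → Fin (suc n)
prependMax f zero    = fromℕ _
prependMax f (suc i) = inject₁ (f i)
appendMax {n} f = snoc (inject₁ ∘ f) (fromℕ n)

appendMax-fromℕ : (f : Fin n → Fin n) → appendMax f (fromℕ n) ≡ fromℕ n
appendMax-fromℕ {n} f = snoc-fromℕ (inject₁ ∘ f) (fromℕ n)

appendMax-inject₁ : (f : Fin n → Fin n) (i : Fin n) → appendMax f (inject₁ i) ≡ inject₁ (f i)
appendMax-inject₁ {n} f = snoc-inject₁ (inject₁ ∘ f) (fromℕ n)

module _ {f : Fin n → Fin n} where

  prependMax⁺ : n ≢ d → ShiftedD (suc d) f → ShiftedD d (prependMax f)
  prependMax⁺ {d} n≢d (f-inj , ¬231 , ¬132 , off) = g-inj , ¬231′ , ¬132′ , off′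
    where
    g-inj : Injective _≡_ _≡_ (prependMax f)
    g-inj {zero}  {zero}  _ = refl
    g-inj {zero}  {suc _} e = ⊥-elim (Fin.fromℕ≢inject₁ e)
    g-inj {suc _} {zero}  e = ⊥-elim (Fin.fromℕ≢inject₁ (sym e))
    g-inj {suc _} {suc _} e = cong suc (f-inj (Fin.inject₁-injective e))

    ¬231′ : ¬ Contains231 (prependMax f)
    ¬231′ (zero  , _     , _     , _       , _       , _ , max<) = fromℕ-maximal max<
    ¬231′ (suc i , suc j , suc l , s<s i<j , s<s j<l , r , s) =
      ¬231 (i , j , l , i<j , j<l , inject₁-cancel-< r , inject₁-cancel-< s)

    ¬132′ : ¬ Contains132 (prependMax f)
    ¬132′ (zero  , _     , _     , _       , _       , max< , _) = fromℕ-maximal max<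
    ¬132′ (suc i , suc j , suc l , s<s i<j , s<s j<l , r , s) =
      ¬132 (i , j , l , i<j , j<l , inject₁-cancel-< r , inject₁-cancel-< s)

    off′ : OffDiagonal d (prependMax f)
    off′ zero    e = n≢d (trans (sym (Fin.toℕ-fromℕ n)) e)
    off′ (suc i) e =
      off i (trans (sym (Fin.toℕ-inject₁ (f i))) (trans e (sym (ℕ.+-suc (toℕ i) d))))

  prependMax⁻ : ShiftedD d (prependMax f) → n ≢ d × ShiftedD (suc d) f
  prependMax⁻ {d} (g-inj , ¬231 , ¬132 , off) =
    (λ n≡d → off zero (trans (Fin.toℕ-fromℕ n) n≡d)) ,
    (λ e → Fin.suc-injective (g-inj (cong inject₁ e))) ,
    ¬231 ∘ Contains231-transport s<s inject₁-mono-< (λ _ → refl) ,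
    ¬132 ∘ Contains132-transport s<s inject₁-mono-< (λ _ → refl) ,
    λ i e → off (suc i) (trans (Fin.toℕ-inject₁ (f i)) (trans e (ℕ.+-suc (toℕ i) d)))

  appendMax⁺ : 0 ≢ d → ShiftedD d f → ShiftedD d (appendMax f)
  appendMax⁺ {d} 0≢d (f-inj , ¬231 , ¬132 , off) = g-inj , ¬231′ , ¬132′ , off′
    where
    g-inj : Injective _≡_ _≡_ (appendMax f)
    g-inj {x} {y} e with lastView x | lastView y
    ... | last   | last   = refl
    ... | last   | init j = ⊥-elim (Fin.fromℕ≢inject₁
      (trans (sym (appendMax-fromℕ f)) (trans e (appendMax-inject₁ f j))))
    ... | init i | last   = ⊥-elim (Fin.fromℕ≢inject₁
      (trans (sym (appendMax-fromℕ f)) (trans (sym e) (appendMax-inject₁ f i))))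
    ... | init i | init j = cong inject₁ (f-inj (Fin.inject₁-injective
      (trans (sym (appendMax-inject₁ f i)) (trans e (appendMax-inject₁ f j)))))

    cancel-< : {i j : Fin n} → appendMax f (inject₁ i) < appendMax f (inject₁ j) → f i < f j
    cancel-< {i} {j} = inject₁-cancel-< ∘
      subst₂ _<_ (appendMax-inject₁ f i) (appendMax-inject₁ f j)

    max≮ : {i : Fin (suc n)} → ¬ appendMax f (fromℕ n) < i
    max≮ = fromℕ-maximal ∘ subst (_< _) (appendMax-fromℕ f)

    ¬231′ : ¬ Contains231 (appendMax f)
    ¬231′ (i , j , l , i<j , j<l , r , s) with lastView l
    ... | last = max≮ r
    ... | init l′ with j′ , refl ← below-inject₁ j<l with i′ , refl ← below-inject₁ i<j =
      ¬231 (i′ , j′ , l′ , inject₁-cancel-< i<j , inject₁-cancel-< j<l , cancel-< r , cancel-< s)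

    ¬132′ : ¬ Contains132 (appendMax f)
    ¬132′ (i , j , l , i<j , j<l , r , s) with lastView l
    ... | last = max≮ s
    ... | init l′ with j′ , refl ← below-inject₁ j<l with i′ , refl ← below-inject₁ i<j =
      ¬132 (i′ , j′ , l′ , inject₁-cancel-< i<j , inject₁-cancel-< j<l , cancel-< r , cancel-< s)

    off′ : OffDiagonal d (appendMax f)
    off′ i e with lastView i
    ... | last = 0≢d (ℕ.+-cancelˡ-≡ _ 0 d
      (trans (ℕ.+-identityʳ _) (subst (λ x → toℕ x ≡ _) (appendMax-fromℕ f) e)))
    ... | init i′ = off i′ (trans (sym (Fin.toℕ-inject₁ (f i′)))
      (trans (sym (cong toℕ (appendMax-inject₁ f i′))) (trans e (cong (_+ d) (Fin.toℕ-inject₁ i′)))))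

  appendMax⁻ : ShiftedD d (appendMax f) → 0 ≢ d × ShiftedD d f
  appendMax⁻ {d} (g-inj , ¬231 , ¬132 , off) =
    (λ { refl → off (fromℕ n)
           (trans (cong toℕ (appendMax-fromℕ f)) (sym (ℕ.+-identityʳ _))) }) ,
    (λ {i} {j} e → Fin.inject₁-injective (g-inj
      (trans (appendMax-inject₁ f i) (trans (cong inject₁ e) (sym (appendMax-inject₁ f j)))))) ,
    ¬231 ∘ Contains231-transport inject₁-mono-< inject₁-mono-< (appendMax-inject₁ f) ,
    ¬132 ∘ Contains132-transport inject₁-mono-< inject₁-mono-< (appendMax-inject₁ f) ,
    λ i e → off (inject₁ i) (trans (cong toℕ (appendMax-inject₁ f i))
      (trans (Fin.toℕ-inject₁ (f i)) (trans e (cong (_+ d) (sym (Fin.toℕ-inject₁ i))))))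

-- Deleting the maximum

factor-inject₁ : (g : A → Fin (suc n)) → (∀ a → g a ≢ fromℕ n) →
                 ∃ λ (f : A → Fin n) → ∀ a → inject₁ (f a) ≡ g a
factor-inject₁ {n = n} g avoids =
  (λ a → lower₁ (g a) (n≢ a)) , λ a → Fin.inject₁-lower₁ (g a) (n≢ a)
  where
  n≢ : ∀ a → n ≢ toℕ (g a)
  n≢ a n≡ga = avoids a (Fin.toℕ-injective (trans (sym n≡ga) (sym (Fin.toℕ-fromℕ n))))

module _ {g : Fin (suc n) → Fin (suc n)} (g-inj : Injective _≡_ _≡_ g) where

  max-attained : ∃ λ p → g p ≡ fromℕ n
  max-attained with Fin.any? (λ p → g p Fin.≟ fromℕ n)
  ... | yes found = found
  ... | no notFound with f , inject₁∘f≗g ← factor-inject₁ g (λ p e → notFound (p , e)) =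
    ⊥-elim (Fin.<⇒notInjective (ℕ.n<1+n n) f-inj)
    where
    f-inj : Injective _≡_ _≡_ f
    f-inj {x} {y} e = g-inj (trans (sym (inject₁∘f≗g x)) (trans (cong inject₁ e) (inject₁∘f≗g y)))

  only-max : {p x : Fin (suc n)} → g p ≡ fromℕ n → x ≢ p → g x ≢ fromℕ n
  only-max gp≡max x≢p gx≡max = x≢p (g-inj (trans gx≡max (sym gp≡max)))

  below-max : {p : Fin (suc n)} → g p ≡ fromℕ n → (x : Fin (suc n)) → x ≢ p → g x < g p
  below-max gp≡max x x≢p =
    subst (g x <_) (sym gp≡max) (Fin.≤∧≢⇒< (Fin.≤fromℕ (g x)) (only-max gp≡max x≢p))

  max-first-or-last : ¬ Contains231 g → ¬ Contains132 g → {p : Fin (suc n)} → g p ≡ fromℕ n →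
                      p ≡ zero ⊎ p ≡ fromℕ n
  max-first-or-last ¬231 ¬132 {p} gp≡max with lastView p
  ... | last         = inj₂ refl
  ... | init zero    = inj₁ refl
  ... | init (suc q) with Fin.<-cmp (g zero) (g (fromℕ n))
  ...   | tri< g₀<gₙ _ _ = ⊥-elim (¬132 (zero , p , fromℕ n , z<s , inject₁<fromℕ (suc q) ,
                                          g₀<gₙ , below-max gp≡max (fromℕ n) Fin.fromℕ≢inject₁))
  ...   | tri> _ _ gₙ<g₀ = ⊥-elim (¬231 (zero , p , fromℕ n , z<s , inject₁<fromℕ (suc q) ,
                                          gₙ<g₀ , below-max gp≡max zero λ ()))
  ...   | tri≈ _ g₀≡gₙ _ with () ← g-inj g₀≡gₙ

  max-first : g zero ≡ fromℕ n → ∃ λ f → prependMax f ≗ g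
  max-first g₀≡max
    with f , inject₁∘f≗g ← factor-inject₁ (g ∘ suc) (λ _ → only-max g₀≡max λ ()) =
    f , λ { zero → sym g₀≡max ; (suc i) → inject₁∘f≗g i }

  max-last : g (fromℕ n) ≡ fromℕ n → ∃ λ f → appendMax f ≗ g
  max-last gₙ≡max
    with f , inject₁∘f≗g ← factor-inject₁ (g ∘ inject₁)
                             (λ _ → only-max gₙ≡max (Fin.fromℕ≢inject₁ ∘ sym)) =
    f , appendMax-f≗g
    where
    appendMax-f≗g : appendMax f ≗ g
    appendMax-f≗g i with lastView i
    ... | last    = trans (appendMax-fromℕ f) (sym gₙ≡max)
    ... | init i′ = trans (appendMax-inject₁ f i′) (inject₁∘f≗g i′)

  split-at-max : ¬ Contains231 g → ¬ Contains132 g →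
                 (∃ λ f → prependMax f ≗ g) ⊎ (∃ λ f → appendMax f ≗ g)
  split-at-max ¬231 ¬132 with p , gp≡max ← max-attained
    with max-first-or-last ¬231 ¬132 gp≡max
  ... | inj₁ refl = inj₁ (max-first gp≡max)
  ... | inj₂ refl = inj₂ (max-last gp≡max)

-- Counting

liftᵛ : ((Fin m → A) → Fin n → B) → Vec A m → Vec B n
liftᵛ F σ = tabulate (F (lookup σ))

lookup-extensional : {u v : Vec A n} → lookup u ≗ lookup v → u ≡ v
lookup-extensional {u = u} {v} u≗v =
  trans (sym (Vec.tabulate∘lookup u)) (trans (Vec.tabulate-cong u≗v) (Vec.tabulate∘lookup v))

module _ (F : (Fin m → A) → Fin n → B) where

  liftᵛ-injective : (∀ {f g} → F f ≗ F g → f ≗ g) → Injective _≡_ _≡_ (liftᵛ F)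
  liftᵛ-injective F-reflects {σ} {τ} e = lookup-extensional (F-reflects λ i →
    trans (sym (Vec.lookup∘tabulate (F (lookup σ)) i))
      (trans (cong (λ v → lookup v i) e) (Vec.lookup∘tabulate (F (lookup τ)) i)))

  liftᵛ-tabulate : (∀ {f g} → f ≗ g → F f ≗ F g) →
                   {f : Fin m → A} {π : Vec B n} → F f ≗ lookup π → liftᵛ F (tabulate f) ≡ π
  liftᵛ-tabulate F-cong {f} {π} Ff≗π = trans
    (Vec.tabulate-cong λ i → trans (F-cong (Vec.lookup∘tabulate f) i) (Ff≗π i))
    (Vec.tabulate∘lookup π)

prependMax-cong : {f g : Fin n → Fin n} → f ≗ g → prependMax f ≗ prependMax g
prependMax-cong f≗g zero    = refl
prependMax-cong f≗g (suc i) = cong inject₁ (f≗g i)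

prependMax-reflects : {f g : Fin n → Fin n} → prependMax f ≗ prependMax g → f ≗ g
prependMax-reflects e i = Fin.inject₁-injective (e (suc i))

appendMax-cong : {f g : Fin n → Fin n} → f ≗ g → appendMax f ≗ appendMax g
appendMax-cong f≗g = snoc-cong _ (cong inject₁ ∘ f≗g)

appendMax-reflects : {f g : Fin n → Fin n} → appendMax f ≗ appendMax g → f ≗ g
appendMax-reflects {f = f} {g} e i = Fin.inject₁-injective
  (trans (sym (appendMax-inject₁ f i)) (trans (e (inject₁ i)) (appendMax-inject₁ g i)))

ShiftedDᵛ : ℕ → Pred (Vec (Fin n) n) 0ℓ
ShiftedDᵛ d = lookup ⊢ ShiftedD d

ShiftedD-tabulate : {f : Fin n → Fin n} → ShiftedD d f → ShiftedDᵛ d (tabulate f)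
ShiftedD-tabulate {f = f} = ShiftedD-resp (sym ∘ Vec.lookup∘tabulate f)

hasCard-ShiftedD-step : {m₁ m₂ : ℕ} →
  HasCard (ShiftedDᵛ {suc n} (suc d)) m₁ → HasCard (ShiftedDᵛ {suc n} d) m₂ →
  HasCard (ShiftedDᵛ {suc (suc n)} d) (unless (suc n ℕ.≟ d) m₁ + unless (0 ℕ.≟ d) m₂)
hasCard-ShiftedD-step {n} {d} count₁ count₂ = hasCard-cong sound complete (hasCard-∪
  (hasCard-image (liftᵛ prependMax) (liftᵛ-injective prependMax prependMax-reflects)
    (hasCard-unless (suc n ℕ.≟ d) count₁))
  (hasCard-image (liftᵛ appendMax) (liftᵛ-injective appendMax appendMax-reflects)
    (hasCard-unless (0 ℕ.≟ d) count₂))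
  disjoint)
  where
  Prepended Appended : Pred (Vec (Fin (suc (suc n))) (suc (suc n))) 0ℓ
  Prepended = Image (liftᵛ prependMax) (λ σ → suc n ≢ d × ShiftedDᵛ (suc d) σ)
  Appended  = Image (liftᵛ appendMax)  (λ σ → 0 ≢ d × ShiftedDᵛ d σ)

  disjoint : Prepended ⊥ Appended
  disjoint ((_ , _ , refl) , (_ , _ , e)) = Fin.fromℕ≢inject₁ (cong (λ π → lookup π zero) (sym e))

  sound : Prepended ∪ Appended ⊆ ShiftedDᵛ d
  sound (inj₁ (_ , (n≢d , σ∈) , refl)) = ShiftedD-tabulate (prependMax⁺ n≢d σ∈)
  sound (inj₂ (_ , (0≢d , σ∈) , refl)) = ShiftedD-tabulate (appendMax⁺ 0≢d σ∈)

  complete : ShiftedDᵛ d ⊆ Prepended ∪ Appended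
  complete π∈@(π-inj , ¬231 , ¬132 , _) with split-at-max π-inj ¬231 ¬132
  ... | inj₁ (f , f≗π) = inj₁ (tabulate f ,
    map₂ ShiftedD-tabulate (prependMax⁻ (ShiftedD-resp (sym ∘ f≗π) π∈)) ,
    liftᵛ-tabulate prependMax prependMax-cong f≗π)
  ... | inj₂ (f , f≗π) = inj₂ (tabulate f ,
    map₂ ShiftedD-tabulate (appendMax⁻ (ShiftedD-resp (sym ∘ f≗π) π∈)) ,
    liftᵛ-tabulate appendMax appendMax-cong f≗π)

countShiftedD : ℕ → ℕ → ℕ
countShiftedD zero          d = 1
countShiftedD (suc zero)    d = unless (0 ℕ.≟ d) 1
countShiftedD (suc (suc n)) d =
  unless (suc n ℕ.≟ d) (countShiftedD (suc n) (suc d)) + unless (0 ℕ.≟ d) (countShiftedD (suc n) d)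

hasCard-ShiftedD : ∀ n d → HasCard (ShiftedDᵛ {n} d) (countShiftedD n d)
hasCard-ShiftedD zero d = hasCard-cong
  (λ { refl → (λ { {()} }) , (λ { (() , _) }) , (λ { (() , _) }) , λ () })
  (λ { {[]} _ → refl })
  (hasCard-singleton [])
hasCard-ShiftedD (suc zero) d = hasCard-cong
  (λ { (0≢d , refl) → (λ { {zero} {zero} _ → refl }) , (λ { (zero , zero , _ , () , _) }) ,
                      (λ { (zero , zero , _ , () , _) }) , λ { zero → 0≢d } })
  (λ { {zero ∷ []} (_ , _ , _ , off) → off zero , refl })
  (hasCard-unless (0 ℕ.≟ d) (hasCard-singleton (zero ∷ [])))
hasCard-ShiftedD (suc (suc n)) d =
  hasCard-ShiftedD-step (hasCard-ShiftedD (suc n) (suc d)) (hasCard-ShiftedD (suc n) d)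

-- The Jacobsthal recurrence

unless-*ˡ : (c : Dec X) (k x : ℕ) → unless c (k * x) ≡ k * unless c x
unless-*ˡ (yes _) k x = sym (ℕ.*-zeroʳ k)
unless-*ˡ (no _)  k x = refl

-- The recursion's conditions depend only on n − d, apart from 0 ≢ d, which holds for positive shifts.
countShiftedD-double : ∀ n d → countShiftedD (suc (suc n)) (suc (suc d)) ≡ 2 * countShiftedD (suc n) (suc d)
countShiftedD-double zero    d = refl
countShiftedD-double (suc n) d = begin
  unless (suc (suc n) ℕ.≟ suc (suc d)) (countShiftedD (suc (suc n)) (suc (suc (suc d))))
    + countShiftedD (suc (suc n)) (suc (suc d))
    ≡⟨ cong₂ _+_ (cong (unless (suc n ℕ.≟ suc d)) (countShiftedD-double n (suc d)))
                 (countShiftedD-double n d) ⟩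
  unless (suc n ℕ.≟ suc d) (2 * countShiftedD (suc n) (suc (suc d))) + 2 * countShiftedD (suc n) (suc d)
    ≡⟨ cong (_+ 2 * countShiftedD (suc n) (suc d)) (unless-*ˡ (suc n ℕ.≟ suc d) 2 _) ⟩
  2 * unless (suc n ℕ.≟ suc d) (countShiftedD (suc n) (suc (suc d))) + 2 * countShiftedD (suc n) (suc d)
    ≡⟨ ℕ.*-distribˡ-+ 2 (unless (suc n ℕ.≟ suc d) (countShiftedD (suc n) (suc (suc d))))
                        (countShiftedD (suc n) (suc d)) ⟨
  2 * countShiftedD (suc (suc n)) (suc d) ∎
  where open ≡-Reasoning

countShiftedD-1 : ∀ n → countShiftedD (suc n) 1 ≡ J (suc n)
countShiftedD-1 zero          = refl
countShiftedD-1 (suc zero)    = refl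
countShiftedD-1 (suc (suc n)) = begin
  countShiftedD (suc (suc n)) 2 + countShiftedD (suc (suc n)) 1
    ≡⟨ cong₂ _+_ (countShiftedD-double n 0) (countShiftedD-1 (suc n)) ⟩
  2 * countShiftedD (suc n) 1 + J (suc (suc n))
    ≡⟨ cong (λ x → 2 * x + J (suc (suc n))) (countShiftedD-1 n) ⟩
  2 * J (suc n) + J (suc (suc n))
    ≡⟨ ℕ.+-comm (2 * J (suc n)) _ ⟩
  J (suc (suc (suc n))) ∎
  where open ≡-Reasoning

-- The binomial sum

sum-applyUpTo-suc : (f : ℕ → ℕ) (n : ℕ) → sum (applyUpTo f (suc n)) ≡ sum (applyUpTo f n) + f n
sum-applyUpTo-suc f n = begin
  sum (applyUpTo f (suc n))            ≡⟨ cong sum (List.applyUpTo-∷ʳ f n) ⟨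
  sum (applyUpTo f n ++ˡ f n ∷ [])     ≡⟨ sum-++ (applyUpTo f n) (f n ∷ []) ⟩
  sum (applyUpTo f n) + (f n + 0)      ≡⟨ cong (sum (applyUpTo f n) +_) (ℕ.+-identityʳ (f n)) ⟩
  sum (applyUpTo f n) + f n            ∎
  where open ≡-Reasoning

sum-applyUpTo-cong : {f g : ℕ → ℕ} (n : ℕ) → (∀ {k} → k ℕ.< n → f k ≡ g k) →
                     sum (applyUpTo f n) ≡ sum (applyUpTo g n)
sum-applyUpTo-cong zero    f≡g = refl
sum-applyUpTo-cong (suc n) f≡g = cong₂ _+_ (f≡g z<s) (sum-applyUpTo-cong n (f≡g ∘ s<s))

sum-applyUpTo-+ : (f g : ℕ → ℕ) (n : ℕ) →
                  sum (applyUpTo (λ k → f k + g k) n) ≡ sum (applyUpTo f n) + sum (applyUpTo g n)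
sum-applyUpTo-+ f g zero    = refl
sum-applyUpTo-+ f g (suc n) = trans (cong (f 0 + g 0 +_) (sum-applyUpTo-+ (f ∘ suc) (g ∘ suc) n))
  (+-interchange (f 0) (g 0) _ _)

sum-applyUpTo-* : (c : ℕ) (f : ℕ → ℕ) (n : ℕ) →
                  sum (applyUpTo (λ k → c * f k) n) ≡ c * sum (applyUpTo f n)
sum-applyUpTo-* c f zero    = sym (ℕ.*-zeroʳ c)
sum-applyUpTo-* c f (suc n) = trans (cong (c * f 0 +_) (sum-applyUpTo-* c (f ∘ suc) n))
  (sym (ℕ.*-distribˡ-+ c (f 0) _))

jacobTerm : ℕ → ℕ → ℕ
jacobTerm n k = 2 ^ (n ∸ k) * (k C (n ∸ k))

jacobTerm-diagonal : ∀ n → jacobTerm n n ≡ 1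
jacobTerm-diagonal n rewrite ℕ.n∸n≡0 n = refl

jacobTerm-pascal : ∀ {n k} → k ℕ.≤ n →
                   jacobTerm (suc (suc n)) (suc k) ≡ 2 * jacobTerm n k + jacobTerm (suc n) k
jacobTerm-pascal {n} {k} k≤n rewrite ℕ.+-∸-assoc 1 k≤n = begin
  2 * 2 ^ j * (suc k C suc j)
    ≡⟨ cong (2 * 2 ^ j *_) (nCk+nC[k+1]≡[n+1]C[k+1] k j) ⟨
  2 * 2 ^ j * (k C j + k C suc j)
    ≡⟨ ℕ.*-distribˡ-+ (2 * 2 ^ j) (k C j) (k C suc j) ⟩
  2 * 2 ^ j * (k C j) + 2 * 2 ^ j * (k C suc j)
    ≡⟨ cong (_+ 2 * 2 ^ j * (k C suc j)) (ℕ.*-assoc 2 (2 ^ j) (k C j)) ⟩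
  2 * (2 ^ j * (k C j)) + 2 * 2 ^ j * (k C suc j) ∎
  where
  open ≡-Reasoning
  j = n ∸ k

jacobSum-applyUpTo : ∀ n → jacobSum n ≡ sum (applyUpTo (jacobTerm n) (suc n))
jacobSum-applyUpTo n = cong sum (List.map-upTo (jacobTerm n) (suc n))

jacobSum-suc² : ∀ n → jacobSum (2 + n) ≡ jacobSum (1 + n) + 2 * jacobSum n
jacobSum-suc² n = begin
  jacobSum (2 + n)
    ≡⟨ jacobSum-applyUpTo (2 + n) ⟩
  jacobTerm (2 + n) 0 + sum (applyUpTo (jacobTerm (2 + n) ∘ suc) (2 + n))
    ≡⟨ cong₂ _+_ (ℕ.*-zeroʳ (2 ^ (2 + n))) (sum-applyUpTo-suc (jacobTerm (2 + n) ∘ suc) (1 + n)) ⟩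
  sum (applyUpTo (jacobTerm (2 + n) ∘ suc) (1 + n)) + jacobTerm (2 + n) (2 + n)
    ≡⟨ cong₂ _+_ (sum-applyUpTo-cong (1 + n) (jacobTerm-pascal ∘ ℕ.s≤s⁻¹))
                 (jacobTerm-diagonal (2 + n)) ⟩
  sum (applyUpTo (λ k → 2 * jacobTerm n k + jacobTerm (1 + n) k) (1 + n)) + 1
    ≡⟨ cong (_+ 1) (trans (sum-applyUpTo-+ (λ k → 2 * jacobTerm n k) (jacobTerm (1 + n)) (1 + n))
                          (cong (_+ S (1 + n)) (sum-applyUpTo-* 2 (jacobTerm n) (1 + n)))) ⟩
  2 * S n + S (1 + n) + 1
    ≡⟨ ℕ.+-assoc (2 * S n) (S (1 + n)) 1 ⟩
  2 * S n + (S (1 + n) + 1)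
    ≡⟨ cong₂ (λ x y → 2 * x + (S (1 + n) + y)) (jacobSum-applyUpTo n) (jacobTerm-diagonal (1 + n)) ⟨
  2 * jacobSum n + (S (1 + n) + jacobTerm (1 + n) (1 + n))
    ≡⟨ cong (2 * jacobSum n +_) (trans (jacobSum-applyUpTo (1 + n))
                                       (sum-applyUpTo-suc (jacobTerm (1 + n)) (1 + n))) ⟨
  2 * jacobSum n + jacobSum (1 + n)
    ≡⟨ ℕ.+-comm (2 * jacobSum n) (jacobSum (1 + n)) ⟩
  jacobSum (1 + n) + 2 * jacobSum n ∎
  where
  open ≡-Reasoning
  S : ℕ → ℕ
  S m = sum (applyUpTo (jacobTerm m) (1 + n))

J≡jacobSum : ∀ n → J (suc n) ≡ jacobSum n
J≡jacobSum zero          = refl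
J≡jacobSum (suc zero)    = refl
J≡jacobSum (suc (suc n)) = begin
  J (2 + n) + 2 * J (1 + n)          ≡⟨ cong₂ (λ x y → x + 2 * y) (J≡jacobSum (suc n)) (J≡jacobSum n) ⟩
  jacobSum (1 + n) + 2 * jacobSum n  ≡⟨ jacobSum-suc² n ⟨
  jacobSum (2 + n)                   ∎
  where open ≡-Reasoning

InD⊆ShiftedDᵛ₀ : InD n ⊆ ShiftedDᵛ 0
InD⊆ShiftedDᵛ₀ (π-inj , derangement , ¬231 , ¬132) =
  π-inj , ¬231 , ¬132 , λ i e → derangement i (Fin.toℕ-injective (trans e (ℕ.+-identityʳ _)))

ShiftedDᵛ₀⊆InD : ShiftedDᵛ 0 ⊆ InD n
ShiftedDᵛ₀⊆InD (π-inj , ¬231 , ¬132 , off) =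
  π-inj , (λ i e → off i (trans (cong toℕ e) (sym (ℕ.+-identityʳ _)))) , ¬231 , ¬132

hasCard-InD : ∀ n → HasCard (InD n) (countShiftedD n 0)
hasCard-InD n = hasCard-cong (λ {π} → ShiftedDᵛ₀⊆InD {x = π}) (λ {π} → InD⊆ShiftedDᵛ₀ {x = π})
  (hasCard-ShiftedD n 0)

countShiftedD-derangements : ∀ n → countShiftedD (2 + n) 0 ≡ J (suc n)
countShiftedD-derangements n = trans (ℕ.+-identityʳ _) (countShiftedD-1 n)

theorem5p1 : (n : ℕ) →
    (J (suc n) ≡ jacobSum n) × HasCard (InD (n + 2)) (J (suc n))
theorem5p1 n =
  J≡jacobSum n ,
  subst₂ (λ m c → HasCard (InD m) c) (ℕ.+-comm 2 n) (countShiftedD-derangements n)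
    (hasCard-InD (2 + n))
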